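{- A search tree $T$ on a tree $S$ is Steiner-closed if and only if it is a $2$-cut search tree.
   Context: A search tree on an unrooted tree $S$ (STT) is a rooted tree $T$ with $V(T)=V(S)$ defined recursively: the root $r$ is any node of $S$, and the subtrees of $T$ rooted at the children of $r$ are search trees on the connected components of $S\setminus r$. $T_x$ is the subtree of $T$ rooted at $x$; $\delta(T_x)$ is the set of nodes outside $V(T_x)$ adjacent in $S$ to a node of $V(T_x)$; $T$ is a $2$-cut tree if $|\delta(T_x)|\le 2$ for all $x$. The convex hull $\mathrm{ch}(A)$ of $A\subseteq V(S)$ is the subtree of $S$ induced by the union of all paths between nodes of $A$. $A$ is Steiner-closed if every node of $\mathrm{ch}(A)\setminus A$ is adjacent to exactly two nodes of $\mathrm{ch}(A)$. $T$ is Steiner-closed if for every $x\in V(S)$ the set of nodes on the root-to-$x$ path in $T$ is Steiner-closed. -}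

module Defs where

open import Data.Nat using (ℕ; _≤_)
open import Data.Fin using (Fin; _≟_)
open import Data.Bool using (Bool; true; false)
open import Data.List using (List; []; _∷_; _++_; length; lookup; filter)
open import Data.List.Membership.Propositional using (_∈_; _∉_)
open import Data.List.Relation.Unary.All using (All)
import Data.List.Membership.DecPropositional
open import Data.List.Relation.Unary.Any using (Any; any?)
open import Data.List.Relation.Unary.Unique.Propositional using (Unique)
open import Data.Product using (Σ; ∃; _×_; _,_)
open import Data.Sum using (_⊎_)
open import Relation.Binary.PropositionalEquality using (_≡_; _≢_)
open import Relation.Nullary using (¬_)
open import Relation.Nullary.Decidable using (_×-dec_; ¬?)
open import Data.List.Base using () renaming (allFin to allFinL)
open import Data.Bool.Properties using () renaming (_≟_ to _≟ᵇ_)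

Adjacency : ℕ → Set
Adjacency n = Fin n → Fin n → Bool

module _ {n : ℕ} (adj : Adjacency n) where

  Adj : Fin n → Fin n → Set
  Adj x y = adj x y ≡ true

  data Walk : Fin n → Fin n → List (Fin n) → Set where
    here : ∀ {x} → Walk x x (x ∷ [])
    step : ∀ {x y z p} → Adj x y → Walk y z p → Walk x z (x ∷ p)

  Path : Fin n → Fin n → List (Fin n) → Set
  Path x y p = Walk x y p × Unique p

record UTree (n : ℕ) : Set where
  field
    adj        : Adjacency n
    symmetric  : ∀ x y → adj x y ≡ adj y x
    irreflexive : ∀ x → adj x x ≡ false
    connected  : ∀ x y → ∃ λ p → Path adj x y p
    acyclic    : ∀ x y p q → Path adj x y p → Path adj x y q → p ≡ q

data RTree (n : ℕ) : Set where
  node : Fin n → List (RTree n) → RTree n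

module _ {n : ℕ} where

  root : RTree n → Fin n
  root (node r _) = r

  children : RTree n → List (RTree n)
  children (node _ ts) = ts

  mutual
    labels : RTree n → List (Fin n)
    labels (node r ts) = r ∷ labelsL ts

    labelsL : List (RTree n) → List (Fin n)
    labelsL [] = []
    labelsL (t ∷ ts) = labels t ++ labelsL ts

  data _≼_ : RTree n → RTree n → Set where
    ≼-refl  : ∀ {t} → t ≼ t
    ≼-child : ∀ {s c t} → s ≼ c → c ∈ children t → s ≼ t

module _ {n : ℕ} (adj : Adjacency n) where

  private module DecM = Data.List.Membership.DecPropositional (_≟_ {n = n})

  V : RTree n → Fin n → Set
  V t x = x ∈ labels t

  Connected : (Fin n → Set) → Set
  Connected C = ∀ x y → C x → C y → ∃ λ p → Walk adj x y p × All C p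

  IsComponent : (Fin n → Set) → (Fin n → Set) → Set
  IsComponent W C =
    (∀ x → C x → W x) × Connected C ×
    (∀ x y → C x → W y → Adj adj x y → C y)

  data IsSTT : (Fin n → Set) → RTree n → Set₁ where
    stt : ∀ {U r ts} →
          U r →
          All (λ c → IsComponent (λ y → U y × y ≢ r) (V c) × IsSTT (V c) c) ts →
          (∀ y → U y → y ≢ r →
             Σ (Fin (length ts)) λ i → V (lookup ts i) y ×
               (∀ j → V (lookup ts j) y → j ≡ i)) →
          IsSTT U (node r ts)

  SearchTree : RTree n → Set₁
  SearchTree t = IsSTT (λ _ → Fin n) t

  InDelta : RTree n → Fin n → Set
  InDelta s y = y ∉ labels s × Any (Adj adj y) (labels s)

  delta : RTree n → List (Fin n)
  delta s = filter (λ y → ¬? (y DecM.∈? labels s)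
                          ×-dec any? (λ z → adj y z ≟ᵇ true) (labels s))
                   (allFinL n)

  TwoCut : RTree n → Set
  TwoCut t = ∀ s → s ≼ t → length (delta s) ≤ 2

  ch : (Fin n → Set) → Fin n → Set
  ch A v = ∃ λ a → ∃ λ b → ∃ λ p → A a × A b × Path adj a b p × v ∈ p

  ExactlyTwo : (Fin n → Set) → Set
  ExactlyTwo P = ∃ λ w₁ → ∃ λ w₂ → w₁ ≢ w₂ × P w₁ × P w₂ ×
                   (∀ w → P w → w ≡ w₁ ⊎ w ≡ w₂)

  SteinerClosedSet : (Fin n → Set) → Set
  SteinerClosedSet A =
    ∀ v → ch A v → ¬ A v → ExactlyTwo (λ w → Adj adj v w × ch A w)

  -- nodes on the root-to-x path in t (the ancestors of x, including x)
  RootPath : RTree n → Fin n → Fin n → Set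
  RootPath t x y = ∃ λ s → s ≼ t × root s ≡ y × x ∈ labels s

  SteinerClosed : RTree n → Set
  SteinerClosed t = ∀ x → SteinerClosedSet (RootPath t x)

module Submission where

-- Let A be the set of ancestors of x in T and v ∈ ch(A) ∖ A. The subtree T_v is disjoint
-- from A, and every neighbour w of v in ch(A) starts a path from v to A; that path leaves
-- T_v through a node of δ(T_v), and since S is a tree, distinct neighbours leave through
-- distinct nodes. So if |δ(T_v)| ≤ 2, v has no neighbours in ch(A) besides the two it has
-- on a path of ch(A) through v.
-- Conversely, if T_x has three boundary nodes, they are ancestors of the parent p of x,
-- while T_x is connected and avoids the ancestors of p. Paths inside T_x joining the three
-- boundary nodes meet in a node m outside that ancestor set with three neighbours in its
-- convex hull, so the ancestor set of p is not Steiner-closed.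

open import Defs
open import Data.Nat using (ℕ; suc; _≤_; _<_; _≤?_; z≤n; s≤s)
open import Data.Nat.Properties using (≰⇒>; ≤⇒≯; n≮n)
open import Data.Fin using (Fin; _≟_)
open import Data.List using (List; []; _∷_; _++_; [_]; length; lookup; reverse; allFin)
open import Data.List.Properties using (reverse-++; unfold-reverse)
open import Data.List.Membership.Propositional using (_∈_; _∉_; lose; find)
open import Data.List.Membership.Propositional.Properties
  using (∈-++⁺ˡ; ∈-++⁺ʳ; ∈-++⁻; ∈-∃++; ∈-lookup; ∈-filter⁺; ∈-filter⁻; ∈-allFin)
import Data.List.Membership.DecPropositional as DecMembership
open import Data.List.Relation.Unary.All using (All; []; _∷_)
import Data.List.Relation.Unary.All as All
open import Data.List.Relation.Unary.All.Properties using (++⁻ˡ; ++⁻ʳ; ¬Any⇒All¬; All¬⇒¬Any)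
open import Data.List.Relation.Unary.Any using (Any; here; there; index)
open import Data.List.Relation.Unary.Any.Properties using (reverse⁻; lookup-index)
open import Data.List.Relation.Unary.AllPairs using ([]; _∷_)
open import Data.List.Relation.Unary.Unique.Propositional using (Unique)
open import Data.List.Relation.Unary.Unique.Propositional.Properties using (++⁺; filter⁺; allFin⁺)
open import Data.List.Relation.Binary.Disjoint.Propositional using (Disjoint)
open import Data.List.Relation.Binary.Subset.Propositional using (_⊆_)
open import Data.Product using (∃; ∃₂; _×_; _,_; proj₁; proj₂)
open import Data.Sum using (_⊎_; inj₁; inj₂; [_,_]′)
open import Data.Empty using (⊥-elim)
open import Function using (_∘_)
open import Function.Bundles using (_⇔_; mk⇔)
open import Relation.Nullary using (¬_; yes; no)
open import Relation.Unary using (Decidable)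
open import Relation.Binary.PropositionalEquality
  using (_≡_; _≢_; refl; sym; trans; cong; subst; module ≡-Reasoning)

module _ {A : Set} where

  Unique-++⁻ : ∀ (xs : List A) {ys} → Unique (xs ++ ys) → Unique xs × Unique ys × Disjoint xs ys
  Unique-++⁻ []       u          = [] , u , λ { (() , _) }
  Unique-++⁻ (x ∷ xs) (x∉ ∷ u) with Unique-++⁻ xs u
  ... | uxs , uys , disjoint = ++⁻ˡ xs x∉ ∷ uxs , uys , λ where
    (here refl , x∈ys) → All¬⇒¬Any (++⁻ʳ xs x∉) x∈ys
    (there v∈xs , v∈ys) → disjoint (v∈xs , v∈ys)

  Unique-∷ʳ : ∀ {xs : List A} {x} → Unique xs → x ∉ xs → Unique (xs ++ [ x ])
  Unique-∷ʳ u x∉xs = ++⁺ u ([] ∷ []) λ { (x∈xs , here refl) → x∉xs x∈xs }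

  Unique-reverse : ∀ (xs : List A) → Unique xs → Unique (reverse xs)
  Unique-reverse []       u          = u
  Unique-reverse (x ∷ xs) (x∉ ∷ u) rewrite unfold-reverse x xs =
    Unique-∷ʳ (Unique-reverse xs u) (All¬⇒¬Any x∉ ∘ reverse⁻)

  first-split : ∀ {P : A → Set} → Decidable P → ∀ {xs} → Any P xs →
                ∃₂ λ ys m → ∃ λ zs → xs ≡ ys ++ m ∷ zs × P m × All (¬_ ∘ P) ys
  first-split P? {x ∷ xs} any with P? x | any
  ... | yes px | _        = [] , x , xs , refl , px , []
  ... | no ¬px | here px  = ⊥-elim (¬px px)
  ... | no ¬px | there any′ with first-split P? any′
  ...   | ys , m , zs , refl , pm , ¬pys = x ∷ ys , m , zs , refl , pm , ¬px ∷ ¬pys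

  ∈-remove : ∀ {x} {xs : List A} → x ∈ xs →
           ∃ λ xs′ → length xs ≡ suc (length xs′) × (∀ {y} → y ∈ xs → y ≢ x → y ∈ xs′)
  ∈-remove {xs = _ ∷ xs} (here refl) = xs , refl , λ where
    (here refl) y≢x → ⊥-elim (y≢x refl)
    (there y∈)  _   → y∈
  ∈-remove {xs = z ∷ _} (there x∈) with ∈-remove x∈
  ... | xs′ , eq , sub = z ∷ xs′ , cong suc eq , λ where
    (here refl) _   → here refl
    (there y∈)  y≢x → there (sub y∈ y≢x)

  Unique-⊆⇒length≤ : ∀ {xs ys : List A} → Unique xs → xs ⊆ ys → length xs ≤ length ys
  Unique-⊆⇒length≤ []            _  = z≤n
  Unique-⊆⇒length≤ (x∉ ∷ u) xs⊆ys with ∈-remove (xs⊆ys (here refl))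
  ... | ys′ , eq , sub = subst (_ ≤_) (sym eq)
    (s≤s (Unique-⊆⇒length≤ u λ y∈ → sub (xs⊆ys (there y∈)) λ { refl → All.lookup x∉ y∈ refl }))

data ThreeDistinct {A : Set} (P : A → Set) : Set where
  threeDistinct : ∀ {x y z} → P x → P y → P z → x ≢ y → x ≢ z → y ≢ z → ThreeDistinct P

module _ {A : Set} where

  ThreeDistinct-mono : ∀ {P Q : A → Set} → (∀ {x} → P x → Q x) → ThreeDistinct P → ThreeDistinct Q
  ThreeDistinct-mono f (threeDistinct px py pz x≢y x≢z y≢z) =
    threeDistinct (f px) (f py) (f pz) x≢y x≢z y≢z

  ThreeDistinct-map : ∀ {B : Set} {P : A → Set} {Q : B → Set} (R : A → B → Set) →
                      (∀ {x} → P x → ∃ λ y → Q y × R x y) → (∀ {x x′ y} → R x y → R x′ y → x ≡ x′) →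
                      ThreeDistinct P → ThreeDistinct Q
  ThreeDistinct-map R f injective (threeDistinct px py pz x≢y x≢z y≢z)
    with f px | f py | f pz
  ... | _ , qx , rx | _ , qy , ry | _ , qz , rz =
    threeDistinct qx qy qz (λ { refl → x≢y (injective rx ry) })
                           (λ { refl → x≢z (injective rx rz) })
                           (λ { refl → y≢z (injective ry rz) })

  ThreeDistinct-∈⇒3≤length : ∀ {xs : List A} → ThreeDistinct (_∈ xs) → 3 ≤ length xs
  ThreeDistinct-∈⇒3≤length (threeDistinct x∈ y∈ z∈ x≢y x≢z y≢z) =
    Unique-⊆⇒length≤ ((x≢y ∷ x≢z ∷ []) ∷ (y≢z ∷ []) ∷ [] ∷ []) λ where
      (here refl)                 → x∈
      (there (here refl))         → y∈
      (there (there (here refl))) → z∈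

  Unique⇒ThreeDistinct : ∀ (xs : List A) → Unique xs → 2 < length xs → ThreeDistinct (_∈ xs)
  Unique⇒ThreeDistinct (x ∷ y ∷ z ∷ _) ((x≢y ∷ x≢z ∷ _) ∷ (y≢z ∷ _) ∷ _) _ =
    threeDistinct (here refl) (there (here refl)) (there (there (here refl))) x≢y x≢z y≢z
  Unique⇒ThreeDistinct (_ ∷ _ ∷ []) _ (s≤s (s≤s ()))
  Unique⇒ThreeDistinct (_ ∷ [])     _ (s≤s ())
  Unique⇒ThreeDistinct []           _ ()

module _ {n : ℕ} {adj : Adjacency n} {P : Fin n → Set} where

  ExactlyTwo⇒¬ThreeDistinct : ExactlyTwo adj P → ¬ ThreeDistinct P
  ExactlyTwo⇒¬ThreeDistinct (w₁ , w₂ , _ , _ , _ , only) three =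
    n≮n 2 (ThreeDistinct-∈⇒3≤length (ThreeDistinct-mono (pair ∘ only _) three))
    where
    pair : ∀ {w} → w ≡ w₁ ⊎ w ≡ w₂ → w ∈ w₁ ∷ w₂ ∷ []
    pair = [ here , there ∘ here ]′

  ¬ThreeDistinct⇒ExactlyTwo : ∀ {w₁ w₂} → P w₁ → P w₂ → w₁ ≢ w₂ → ¬ ThreeDistinct P →
                              ExactlyTwo adj P
  ¬ThreeDistinct⇒ExactlyTwo {w₁} {w₂} pw₁ pw₂ w₁≢w₂ ¬three = w₁ , w₂ , w₁≢w₂ , pw₁ , pw₂ , only
    where
    only : ∀ w → P w → w ≡ w₁ ⊎ w ≡ w₂
    only w pw with w ≟ w₁ | w ≟ w₂
    ... | yes w≡w₁ | _        = inj₁ w≡w₁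
    ... | no _     | yes w≡w₂ = inj₂ w≡w₂
    ... | no w≢w₁  | no w≢w₂  =
      ⊥-elim (¬three (threeDistinct pw₁ pw₂ pw w₁≢w₂ (w≢w₁ ∘ sym) (w≢w₂ ∘ sym)))

module _ {n : ℕ} {adj : Adjacency n} where

  open DecMembership (_≟_ {n = n}) using (_∈?_)

  Walk-head : ∀ {x y p} → Walk adj x y p → ∃ λ q → p ≡ x ∷ q
  Walk-head here       = _ , refl
  Walk-head (step _ _) = _ , refl

  Walk-start∈ : ∀ {x y p} → Walk adj x y p → x ∈ p
  Walk-start∈ here       = here refl
  Walk-start∈ (step _ _) = here refl

  Walk-end∈ : ∀ {x y p} → Walk adj x y p → y ∈ p
  Walk-end∈ here         = here refl
  Walk-end∈ (step _ walk) = there (Walk-end∈ walk)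

  Walk-tail : ∀ {v c w q} → Walk adj v c (v ∷ w ∷ q) → Walk adj w c (w ∷ q)
  Walk-tail (step _ walk) with Walk-head walk
  ... | _ , refl = walk

  Walk-second : ∀ {v b q} → Walk adj v b (v ∷ q) → v ≢ b → ∃₂ λ w q′ → q ≡ w ∷ q′ × Adj adj v w
  Walk-second here           v≢b = ⊥-elim (v≢b refl)
  Walk-second (step v~w walk) _  with Walk-head walk
  ... | q′ , refl = _ , q′ , refl , v~w

  Walk-∷ʳ : ∀ {x y z p} → Walk adj x y p → Adj adj y z → Walk adj x z (p ++ [ z ])
  Walk-∷ʳ here          y~z = step y~z here
  Walk-∷ʳ (step e walk) y~z = step e (Walk-∷ʳ walk y~z)

  Walk-split : ∀ pre {u post a b} → Walk adj a b (pre ++ u ∷ post) →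
               Walk adj a u (pre ++ [ u ]) × Walk adj u b (u ∷ post)
  Walk-split []        here          = here , here
  Walk-split []        (step e walk) = here , step e walk
  Walk-split (_ ∷ []) (step e walk) with Walk-head walk
  ... | _ , refl = step e here , walk
  Walk-split (_ ∷ pre@(_ ∷ _)) (step e walk) with Walk-split pre walk
  ... | toU , fromU = step e toU , fromU

  Walk-predecessor : ∀ f pre {m post a b} → Walk adj a b (f ∷ pre ++ m ∷ post) →
                     ∃ λ u → u ∈ f ∷ pre × Adj adj u m
  Walk-predecessor f [] walk with Walk-split (f ∷ []) walk
  ... | step f~m here , _ = f , here refl , f~m
  Walk-predecessor f (f′ ∷ pre) (step _ walk) with Walk-predecessor f′ pre walk
  ... | u , u∈ , u~m = u , there u∈ , u~m

  Walk⇒Path : ∀ {x y p} → Walk adj x y p → ∃ λ q → Path adj x y q × q ⊆ p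
  Walk⇒Path {x} here = x ∷ [] , (here , [] ∷ []) , λ x∈ → x∈
  Walk⇒Path {x} (step e walk) with Walk⇒Path walk
  ... | q , (walkq , uq) , q⊆p with x ∈? q
  ...   | no x∉q = x ∷ q , (step e walkq , ¬Any⇒All¬ q x∉q ∷ uq) , λ where
    (here refl) → here refl
    (there y∈)  → there (q⊆p y∈)
  ...   | yes x∈q with ∈-∃++ x∈q
  ...     | pre , post , refl =
    x ∷ post , (proj₂ (Walk-split pre walkq) , proj₁ (proj₂ (Unique-++⁻ pre uq))) ,
    λ y∈ → there (q⊆p (∈-++⁺ʳ pre y∈))

  Connected⇒Path : ∀ {C x y} → Connected adj C → C x → C y → ∃ λ q → Path adj x y q × All C q
  Connected⇒Path connected cx cy with connected _ _ cx cy
  ... | p , walk , inC with Walk⇒Path walk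
  ... | q , path , q⊆p = q , path , All.tabulate (All.lookup inC ∘ q⊆p)

  Path-extend : ∀ {C : Fin n → Set} {z z′ d d′ p} → Path adj z z′ p → All C p → ¬ C d → ¬ C d′ →
                d ≢ d′ → Adj adj d z → Adj adj z′ d′ → Path adj d d′ (d ∷ p ++ [ d′ ])
  Path-extend {p = p} (walk , unique) inC d∉ d′∉ d≢d′ d~z z′~d′ =
    step d~z (Walk-∷ʳ walk z′~d′) ,
    ¬Any⇒All¬ _ (λ d∈ → [ d∉ ∘ All.lookup inC , (λ { (here d≡d′) → d≢d′ d≡d′ }) ]′ (∈-++⁻ p d∈)) ∷
    Unique-∷ʳ unique (d′∉ ∘ All.lookup inC)

module _ {n : ℕ} where

  mutual
    subtree-at : ∀ (t : RTree n) {x} → x ∈ labels t → ∃ λ s → s ≼ t × root s ≡ x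
    subtree-at (node r ts) (here refl) = node r ts , ≼-refl , refl
    subtree-at (node r ts) (there x∈) with subtree-at* ts x∈
    ... | s , _ , c∈ts , s≼c , e = s , ≼-child s≼c c∈ts , e

    subtree-at* : ∀ (ts : List (RTree n)) {x} → x ∈ labelsL ts →
                  ∃ λ s → ∃ λ c → c ∈ ts × s ≼ c × root s ≡ x
    subtree-at* (c ∷ cs) x∈ with ∈-++⁻ (labels c) x∈
    ... | inj₁ x∈c with subtree-at c x∈c
    ...   | s , s≼c , e = s , c , here refl , s≼c , e
    subtree-at* (c ∷ cs) x∈ | inj₂ x∈cs with subtree-at* cs x∈cs
    ...   | s , c′ , c′∈ , s≼c′ , e = s , c′ , there c′∈ , s≼c′ , e

  ∈-labelsL⁻ : ∀ (ts : List (RTree n)) {x} → x ∈ labelsL ts → ∃ λ c → c ∈ ts × x ∈ labels c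
  ∈-labelsL⁻ (c ∷ cs) x∈ with ∈-++⁻ (labels c) x∈
  ... | inj₁ x∈c  = c , here refl , x∈c
  ... | inj₂ x∈cs with ∈-labelsL⁻ cs x∈cs
  ...   | c′ , c′∈ , x∈c′ = c′ , there c′∈ , x∈c′

  ∈-labelsL⁺ : ∀ {x c} {ts : List (RTree n)} → c ∈ ts → x ∈ labels c → x ∈ labelsL ts
  ∈-labelsL⁺ {ts = c ∷ _}  (here refl) x∈ = ∈-++⁺ˡ x∈
  ∈-labelsL⁺ {ts = c ∷ _}  (there c∈)  x∈ = ∈-++⁺ʳ (labels c) (∈-labelsL⁺ c∈ x∈)

  root∈labels : ∀ (t : RTree n) → root t ∈ labels t
  root∈labels (node _ _) = here refl

  ≼⇒labels⊆ : ∀ {s t : RTree n} → s ≼ t → labels s ⊆ labels t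
  ≼⇒labels⊆ ≼-refl                          x∈ = x∈
  ≼⇒labels⊆ (≼-child {t = node _ _} s≼c c∈) x∈ = there (∈-labelsL⁺ c∈ (≼⇒labels⊆ s≼c x∈))

  ≼-trans : ∀ {s t u : RTree n} → s ≼ t → t ≼ u → s ≼ u
  ≼-trans s≼t ≼-refl           = s≼t
  ≼-trans s≼t (≼-child t≼c c∈) = ≼-child (≼-trans s≼t t≼c) c∈

  ≼-parent : ∀ {s t : RTree n} → s ≼ t → s ≡ t ⊎ ∃ λ p → p ≼ t × s ∈ children p
  ≼-parent ≼-refl = inj₁ refl
  ≼-parent (≼-child {t = t} s≼c c∈) with ≼-parent s≼c
  ... | inj₁ refl              = inj₂ (t , ≼-refl , c∈)
  ... | inj₂ (p , p≼c , s∈p) = inj₂ (p , ≼-child p≼c c∈ , s∈p)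

OnBoundary : ∀ {n} → Adjacency n → (Fin n → Set) → Fin n → Set
OnBoundary adj C d = ¬ C d × ∃ λ z → C z × Adj adj d z

module _ {n : ℕ} {adj : Adjacency n} where

  OnBoundary⇒∈delta : ∀ {s d} → OnBoundary adj (_∈ labels s) d → d ∈ delta adj s
  OnBoundary⇒∈delta (d∉ , z , z∈ , d~z) = ∈-filter⁺ _ (∈-allFin _) (d∉ , lose z∈ d~z)

  ∈delta⇒OnBoundary : ∀ {s d} → d ∈ delta adj s → OnBoundary adj (_∈ labels s) d
  ∈delta⇒OnBoundary d∈ with ∈-filter⁻ _ {xs = allFin n} d∈
  ... | _ , d∉ , d~s with find d~s
  ...   | z , z∈ , d~z = d∉ , z , z∈ , d~z

  delta-Unique : ∀ s → Unique (delta adj s)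
  delta-Unique s = filter⁺ _ (allFin⁺ n)

  child-component : ∀ {U r ts c} → IsSTT adj U (node r ts) → c ∈ ts →
                    IsComponent adj (λ y → U y × y ≢ r) (_∈ labels c)
  child-component (stt _ children _) c∈ = proj₁ (All.lookup children c∈)

  child-labels⊆ : ∀ {U r ts c y} → IsSTT adj U (node r ts) → c ∈ ts → y ∈ labels c → U y × y ≢ r
  child-labels⊆ st c∈ = proj₁ (child-component st c∈) _

  child-closed : ∀ {U r ts c z y} → IsSTT adj U (node r ts) → c ∈ ts →
                 z ∈ labels c → U y → y ≢ r → Adj adj z y → y ∈ labels c
  child-closed st c∈ z∈ Uy y≢r z~y = proj₂ (proj₂ (child-component st c∈)) _ _ z∈ (Uy , y≢r) z~y

  child-connected : ∀ {U r ts c} → IsSTT adj U (node r ts) → c ∈ ts → Connected adj (_∈ labels c)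
  child-connected st c∈ = proj₁ (proj₂ (child-component st c∈))

  child-IsSTT : ∀ {U r ts c} → IsSTT adj U (node r ts) → c ∈ ts → IsSTT adj (_∈ labels c) c
  child-IsSTT (stt _ children _) c∈ = proj₂ (All.lookup children c∈)

  IsSTT-labels⊆ : ∀ {U t x} → IsSTT adj U t → x ∈ labels t → U x
  IsSTT-labels⊆ (stt Ur _ _) (here refl) = Ur
  IsSTT-labels⊆ {t = node _ ts} st (there x∈) with ∈-labelsL⁻ ts x∈
  ... | c , c∈ , x∈c = proj₁ (child-labels⊆ st c∈ x∈c)

  IsSTT-⊆labels : ∀ {U t x} → IsSTT adj U t → U x → x ∈ labels t
  IsSTT-⊆labels {x = x} (stt {r = r} {ts} _ _ cover) Ux with x ≟ r
  ... | yes refl = here refl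
  ... | no x≢r with cover x Ux x≢r
  ...   | i , x∈ , _ = there (∈-labelsL⁺ (∈-lookup {xs = ts} i) x∈)

  IsSTT-≼ : ∀ {U s t} → IsSTT adj U t → s ≼ t → ∃ λ U′ → IsSTT adj U′ s
  IsSTT-≼ st             ≼-refl           = _ , st
  IsSTT-≼ st@(stt _ _ _) (≼-child s≼c c∈) = IsSTT-≼ (child-IsSTT st c∈) s≼c

  child-unique : ∀ {U r ts c₁ c₂ y} → IsSTT adj U (node r ts) → c₁ ∈ ts → c₂ ∈ ts →
                 y ∈ labels c₁ → y ∈ labels c₂ → c₁ ≡ c₂
  child-unique {ts = ts} {c₁} {c₂} {y} st@(stt _ _ cover) c₁∈ c₂∈ y∈c₁ y∈c₂
    with child-labels⊆ st c₁∈ y∈c₁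
  ... | Uy , y≢r with cover y Uy y≢r
  ... | i , _ , only = begin
    c₁                    ≡⟨ lookup-index c₁∈ ⟩
    lookup ts (index c₁∈) ≡⟨ cong (lookup ts) (trans (only _ (at-index c₁∈ y∈c₁))
                                                      (sym (only _ (at-index c₂∈ y∈c₂)))) ⟩
    lookup ts (index c₂∈) ≡⟨ sym (lookup-index c₂∈) ⟩
    c₂                    ∎
    where
    open ≡-Reasoning
    at-index : ∀ {c} (c∈ : c ∈ ts) → y ∈ labels c → y ∈ labels (lookup ts (index c∈))
    at-index c∈ = subst (λ c → y ∈ labels c) (lookup-index c∈)

  ≼-of-root∈ : ∀ {U t s₁ s₂} → IsSTT adj U t → s₁ ≼ t → s₂ ≼ t → root s₂ ∈ labels s₁ → s₂ ≼ s₁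
  ≼-of-root∈ _ ≼-refl s₂≼t _ = s₂≼t
  ≼-of-root∈ st@(stt _ _ _) (≼-child s₁≼c c∈) ≼-refl r∈s₁ =
    ⊥-elim (proj₂ (child-labels⊆ st c∈ (≼⇒labels⊆ s₁≼c r∈s₁)) refl)
  ≼-of-root∈ st@(stt _ _ _) (≼-child s₁≼c₁ c₁∈) (≼-child {s = s₂} s₂≼c₂ c₂∈) r∈s₁
    with child-unique st c₁∈ c₂∈ (≼⇒labels⊆ s₁≼c₁ r∈s₁) (≼⇒labels⊆ s₂≼c₂ (root∈labels s₂))
  ... | refl = ≼-of-root∈ (child-IsSTT st c₁∈) s₁≼c₁ s₂≼c₂ r∈s₁

  RootPath-≼ : ∀ {t′ t x y} → t′ ≼ t → RootPath adj t′ x y → RootPath adj t x y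
  RootPath-≼ t′≼t (s , s≼t′ , e , x∈s) = s , ≼-trans s≼t′ t′≼t , e , x∈s

  RootPath-disjoint : ∀ {U t s x y} → IsSTT adj U t → s ≼ t → x ∉ labels s → y ∈ labels s →
                      ¬ RootPath adj t x y
  RootPath-disjoint st s≼t x∉s y∈s (s′ , s′≼t , refl , x∈s′) =
    x∉s (≼⇒labels⊆ (≼-of-root∈ st s≼t s′≼t y∈s) x∈s′)

module _ {n : ℕ} (S : UTree n) where

  open UTree S
  open DecMembership (_≟_ {n = n}) using (_∈?_)

  Adj-sym : ∀ {x y} → Adj adj x y → Adj adj y x
  Adj-sym {x} {y} x~y = trans (symmetric y x) x~y

  Adj-irrefl : ∀ {x y} → Adj adj x y → x ≢ y
  Adj-irrefl {x} x~x refl with trans (sym x~x) (irreflexive x)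
  ... | ()

  Walk-reverse : ∀ {x y p} → Walk adj x y p → Walk adj y x (reverse p)
  Walk-reverse here = here
  Walk-reverse (step {x = x} {p = p} x~y walk) rewrite unfold-reverse x p =
    Walk-∷ʳ (Walk-reverse walk) (Adj-sym x~y)

  Path-second-unique : ∀ {v d w w′ q q′} →
                       Path adj v d (v ∷ w ∷ q) → Path adj v d (v ∷ w′ ∷ q′) → w ≡ w′
  Path-second-unique path path′ with acyclic _ _ _ _ path path′
  ... | refl = refl

  Path-split : ∀ pre {u post a b} → Path adj a b (pre ++ u ∷ post) →
               Path adj u b (u ∷ post) × Path adj u a (u ∷ reverse pre)
  Path-split pre {u} (walk , unique) with Walk-split pre walk | Unique-++⁻ pre unique
  ... | toU , fromU | uniquePre , uniqueFromU , disjoint =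
    (fromU , uniqueFromU) ,
    (subst (Walk adj u _) (reverse-++ pre [ u ]) (Walk-reverse toU) ,
     ¬Any⇒All¬ _ (λ u∈ → disjoint (reverse⁻ u∈ , here refl)) ∷ Unique-reverse pre uniquePre)

  Path-inner-neighbours : ∀ {a b p v} → Path adj a b p → v ∈ p → v ≢ a → v ≢ b →
                          ∃₂ λ u w → u ∈ p × w ∈ p × u ≢ w × Adj adj v u × Adj adj v w
  Path-inner-neighbours path v∈p v≢a v≢b with ∈-∃++ v∈p
  ... | pre , post , refl with Path-split pre path
  ... | (toB , _) , (toA , _) with Walk-second toB v≢b | Walk-second toA v≢a
  ... | w , _ , refl , v~w | u , _ , pre≡ , v~u =
    u , w , ∈-++⁺ˡ u∈pre , ∈-++⁺ʳ pre (there (here refl)) ,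
    (λ { refl → proj₂ (proj₂ (Unique-++⁻ pre (proj₂ path))) (u∈pre , there (here refl)) }) ,
    v~u , v~w
    where
    u∈pre : u ∈ pre
    u∈pre = reverse⁻ (subst (u ∈_) (sym pre≡) (here refl))

  ch-neighbour-path : ∀ {A v w} → Adj adj v w → ch adj A w →
                      ∃₂ λ c q → A c × Path adj v c (v ∷ w ∷ q)
  ch-neighbour-path {v = v} {w} v~w (a , b , p , Aa , Ab , path , w∈p) with ∈-∃++ w∈p
  ... | pre , post , refl with Path-split pre path | v ∈? (w ∷ post)
  ... | (toB , uniqueToB) , _ | no v∉ = b , post , Ab , step v~w toB , ¬Any⇒All¬ _ v∉ ∷ uniqueToB
  ... | _ , (toA , uniqueToA) | yes v∈ =
    a , reverse pre , Aa , step v~w toA , ¬Any⇒All¬ _ v∉ ∷ uniqueToA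
    where
    v∉ : v ∉ w ∷ reverse pre
    v∉ (here refl)    = Adj-irrefl v~w refl
    v∉ (there v∈pre) = proj₂ (proj₂ (Unique-++⁻ pre (proj₂ path))) (reverse⁻ v∈pre , v∈)

  first-exit : ∀ {C : Fin n → Set} {z w c q} → Decidable C → C z → Adj adj z w →
               Walk adj w c (w ∷ q) → ¬ C c →
               ∃ λ d → ∃₂ λ q₁ q₂ → q ≡ q₁ ++ q₂ × Walk adj w d (w ∷ q₁) × OnBoundary adj C d
  first-exit {w = w} C? Cz z~w walk c∉ with C? w
  ... | no w∉ = w , [] , _ , refl , here , w∉ , _ , Cz , Adj-sym z~w
  first-exit C? Cz z~w here c∉ | yes Cw = ⊥-elim (c∉ Cw)
  first-exit C? Cz z~w (step w~w′ walk) c∉ | yes Cw with Walk-head walk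
  ... | _ , refl with first-exit C? Cw w~w′ walk c∉
  ...   | d , q₁ , q₂ , refl , walk′ , boundary =
    d , _ ∷ q₁ , q₂ , refl , step w~w′ walk′ , boundary

  ch-neighbour-exit : ∀ {C A : Fin n → Set} {v w} → Decidable C → C v → (∀ {y} → A y → ¬ C y) →
                      Adj adj v w → ch adj A w →
                      ∃ λ d → OnBoundary adj C d × ∃ λ q → Path adj v d (v ∷ w ∷ q)
  ch-neighbour-exit C? Cv A⇒¬C v~w chw with ch-neighbour-path v~w chw
  ... | c , q , Ac , walk , unique with first-exit C? Cv v~w (Walk-tail walk) (A⇒¬C Ac)
  ... | d , q₁ , q₂ , refl , walk′ , boundary =
    d , boundary , q₁ , step v~w walk′ , proj₁ (Unique-++⁻ (_ ∷ _ ∷ q₁) unique)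

  tripod : ∀ {C A : Fin n → Set} → Connected adj C →
           ThreeDistinct (λ d → A d × OnBoundary adj C d) →
           ∃ λ m → C m × ch adj A m × ThreeDistinct (λ w → Adj adj m w × ch adj A w)
  tripod {C} {A} connected
    (threeDistinct {d₁} {d₂} {d₃} (A₁ , d₁∉ , z₁ , C₁ , d₁~z₁) (A₂ , d₂∉ , z₂ , C₂ , d₂~z₂)
                   (A₃ , d₃∉ , z₃ , C₃ , d₃~z₃) d₁≢d₂ d₁≢d₃ d₂≢d₃)
    with Connected⇒Path connected C₁ C₂ | Connected⇒Path connected C₃ C₁
  ... | P , pathP , inP | Q , pathQ , inQ
    with first-split (_∈? P) (lose (Walk-end∈ (proj₁ pathQ)) (Walk-start∈ (proj₁ pathP)))
  ... | Q₁ , m , Q₂ , refl , m∈P , Q₁∉P = m , Cm , onX m∈X , branches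
    where
    X Y : List (Fin n)
    X = d₁ ∷ P ++ [ d₂ ]
    Y = d₃ ∷ (Q₁ ++ m ∷ Q₂) ++ [ d₁ ]

    pathX : Path adj d₁ d₂ X
    pathX = Path-extend pathP inP d₁∉ d₂∉ d₁≢d₂ d₁~z₁ (Adj-sym d₂~z₂)

    pathY : Path adj d₃ d₁ Y
    pathY = Path-extend pathQ inQ d₃∉ d₁∉ (d₁≢d₃ ∘ sym) d₃~z₃ (Adj-sym d₁~z₁)

    onX : ∀ {y} → y ∈ X → ch adj A y
    onX y∈ = d₁ , d₂ , X , A₁ , A₂ , pathX , y∈

    onY : ∀ {y} → y ∈ Y → ch adj A y
    onY y∈ = d₃ , d₁ , Y , A₃ , A₁ , pathY , y∈

    Cm : C m
    Cm = All.lookup inP m∈P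

    m∈X : m ∈ X
    m∈X = there (∈-++⁺ˡ m∈P)

    Q₁⊆Y : ∀ {y} → y ∈ d₃ ∷ Q₁ → y ∈ Y
    Q₁⊆Y (here refl) = here refl
    Q₁⊆Y (there y∈)  = there (∈-++⁺ˡ (∈-++⁺ˡ y∈))

    Q₁∉X : ∀ {y} → y ∈ d₃ ∷ Q₁ → y ∉ X
    Q₁∉X (here refl)  (here d₃≡d₁) = d₁≢d₃ (sym d₃≡d₁)
    Q₁∉X (here refl)  (there d₃∈) =
      [ d₃∉ ∘ All.lookup inP , (λ { (here d₃≡d₂) → d₂≢d₃ (sym d₃≡d₂) }) ]′ (∈-++⁻ P d₃∈)
    Q₁∉X (there y∈Q₁) (here refl) = d₁∉ (All.lookup inQ (∈-++⁺ˡ y∈Q₁))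
    Q₁∉X (there y∈Q₁) (there y∈) =
      [ All.lookup Q₁∉P y∈Q₁ , (λ { (here refl) → d₂∉ (All.lookup inQ (∈-++⁺ˡ y∈Q₁)) }) ]′
        (∈-++⁻ P y∈)

    -- m's two neighbours on X, and its predecessor on Y, which is off X as m is where Q first meets P
    branches : ThreeDistinct (λ w → Adj adj m w × ch adj A w)
    branches with Path-inner-neighbours pathX m∈X (λ { refl → d₁∉ Cm }) (λ { refl → d₂∉ Cm })
                | Walk-predecessor d₃ Q₁ (step d₃~z₃ (proj₁ pathQ))
    ... | u , w , u∈X , w∈X , u≢w , m~u , m~w | t , t∈ , t~m =
      threeDistinct (m~u , onX u∈X) (m~w , onX w∈X) (Adj-sym t~m , onY (Q₁⊆Y t∈))
                    u≢w (λ { refl → Q₁∉X t∈ u∈X }) (λ { refl → Q₁∉X t∈ w∈X })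

  ancestor-of-boundary : ∀ {U t s d} → IsSTT adj U t → s ≼ t → U d →
                         OnBoundary adj (_∈ labels s) d → RootPath adj t (root s) d
  ancestor-of-boundary st ≼-refl Ud (d∉ , _) = ⊥-elim (d∉ (IsSTT-⊆labels st Ud))
  ancestor-of-boundary {t = node r ts} {s} {d} st (≼-child {c = c} s≼c c∈) Ud
                       boundary@(_ , z , z∈ , d~z)
    with d ∈? labels c | d ≟ r
  ... | yes d∈c | _ = RootPath-≼ {adj = adj} (≼-child ≼-refl c∈)
                        (ancestor-of-boundary (child-IsSTT st c∈) s≼c d∈c boundary)
  ... | no _ | yes refl = node r ts , ≼-refl , refl , ≼⇒labels⊆ (≼-child s≼c c∈) (root∈labels s)
  ... | no d∉c | no d≢r = ⊥-elim (d∉c (child-closed st c∈ (≼⇒labels⊆ s≼c z∈) Ud d≢r (Adj-sym d~z)))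

module _ {n : ℕ} (S : UTree n) {T : RTree n} (searchTree : SearchTree (UTree.adj S) T) where

  open UTree S
  open DecMembership (_≟_ {n = n}) using (_∈?_)

  ∈labels : ∀ x → x ∈ labels T
  ∈labels x = IsSTT-⊆labels {x = x} searchTree x

  twoCut⇒steinerClosed : TwoCut adj T → SteinerClosed adj T
  twoCut⇒steinerClosed twoCut x v (a , b , p , Aa , Ab , path , v∈p) v∉A
    with subtree-at T (∈labels v)
  ... | s , s≼T , refl
    with Path-inner-neighbours S path v∈p (λ { refl → v∉A Aa }) (λ { refl → v∉A Ab })
  ... | u , w , u∈p , w∈p , u≢w , v~u , v~w =
    ¬ThreeDistinct⇒ExactlyTwo {adj = adj} (v~u , onPath u∈p) (v~w , onPath w∈p) u≢w λ three →
      ≤⇒≯ (twoCut s s≼T)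
          (ThreeDistinct-∈⇒3≤length (ThreeDistinct-map exitVia exit exit-injective three))
    where
    onPath : ∀ {y} → y ∈ p → ch adj (RootPath adj T x) y
    onPath y∈ = a , b , p , Aa , Ab , path , y∈

    A⇒∉s : ∀ {y} → RootPath adj T x y → y ∉ labels s
    A⇒∉s Ay y∈ = RootPath-disjoint searchTree s≼T (λ x∈ → v∉A (s , s≼T , refl , x∈)) y∈ Ay

    exitVia : Fin n → Fin n → Set
    exitVia w d = ∃ λ q → Path adj (root s) d (root s ∷ w ∷ q)

    exit : ∀ {w} → Adj adj (root s) w × ch adj (RootPath adj T x) w →
           ∃ λ d → d ∈ delta adj s × exitVia w d
    exit (v~w , chw) with ch-neighbour-exit S (_∈? labels s) (root∈labels s) A⇒∉s v~w chw
    ... | d , boundary , viaW = d , OnBoundary⇒∈delta boundary , viaW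

    exit-injective : ∀ {w w′ d} → exitVia w d → exitVia w′ d → w ≡ w′
    exit-injective (_ , viaW) (_ , viaW′) = Path-second-unique S viaW viaW′

  boundary-of-child⊆RootPath : ∀ {r ts c d} → node r ts ≼ T → c ∈ ts →
                               OnBoundary adj (_∈ labels c) d → RootPath adj T r d
  boundary-of-child⊆RootPath {r} {ts} {c} {d} p≼T c∈ (d∉c , z , z∈c , d~z)
    with d ≟ r | IsSTT-≼ searchTree p≼T
  ... | yes refl | _ = node r ts , p≼T , refl , here refl
  ... | no d≢r | _ , stp = ancestor-of-boundary S searchTree p≼T d (d∉p , z , z∈p , d~z)
    where
    z∈p : z ∈ labels (node r ts)
    z∈p = ≼⇒labels⊆ (≼-child ≼-refl c∈) z∈c

    d∉p : d ∉ labels (node r ts)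
    d∉p d∈p = d∉c (child-closed stp c∈ z∈c (IsSTT-labels⊆ stp d∈p) d≢r (Adj-sym S d~z))

  delta-child-¬ThreeDistinct : SteinerClosed adj T → ∀ {r ts c} → node r ts ≼ T → c ∈ ts →
                               ¬ ThreeDistinct (_∈ delta adj c)
  delta-child-¬ThreeDistinct steinerClosed {r} {c = c} p≼T c∈ three with IsSTT-≼ searchTree p≼T
  ... | _ , stp
    with tripod S (child-connected stp c∈)
                  (ThreeDistinct-mono
                    (λ d∈ → boundary-of-child⊆RootPath p≼T c∈ (∈delta⇒OnBoundary d∈) , ∈delta⇒OnBoundary d∈)
                    three)
  ... | m , m∈c , chm , branches =
    ExactlyTwo⇒¬ThreeDistinct {adj = adj} (steinerClosed r m chm m∉A) branches
    where
    r∉c : r ∉ labels c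
    r∉c r∈ = proj₂ (child-labels⊆ stp c∈ r∈) refl

    m∉A : ¬ RootPath adj T r m
    m∉A = RootPath-disjoint searchTree (≼-trans (≼-child ≼-refl c∈) p≼T) r∉c m∈c

  steinerClosed⇒twoCut : SteinerClosed adj T → TwoCut adj T
  steinerClosed⇒twoCut steinerClosed s s≼T with length (delta adj s) ≤? 2
  ... | yes ≤2 = ≤2
  ... | no ≰2 with Unique⇒ThreeDistinct (delta adj s) (delta-Unique s) (≰⇒> ≰2) | ≼-parent s≼T
  ... | threeDistinct {d} d∈ _ _ _ _ _ | inj₁ refl =
    ⊥-elim (proj₁ (∈delta⇒OnBoundary d∈) (∈labels d))
  ... | three | inj₂ (node _ _ , p≼T , s∈p) =
    ⊥-elim (delta-child-¬ThreeDistinct steinerClosed p≼T s∈p three)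

lemma12 : ∀ {n : ℕ} (S : UTree n) (T : RTree n) →
          SearchTree (UTree.adj S) T →
          SteinerClosed (UTree.adj S) T ⇔ TwoCut (UTree.adj S) T
lemma12 S T searchTree = mk⇔ (steinerClosed⇒twoCut S searchTree) (twoCut⇒steinerClosed S searchTree)
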